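{- Let $\Delta_c$ be a concrete higher-order unification context with $\Delta_c\rhd\Delta$. Then for every equation $T_1\doteq T_2$ in $\Delta_c$ there is an equation $N_1\doteq N_2$ in $\Delta$ with $\mathrm{exp}^{\Delta_c}_k(T_i)=\mathrm{exp}^{\Delta}_k(N_i)$ for $i=1,2$ and all $k$, and for every recursive definition $\underline r=_dT$ in $\Delta_c$ there is a recursive definition $\underline r=_dU$ in $\Delta$ (with equal expansions of $\lambda\bar x.\,\underline r\,\bar y$ in $\Delta_c$ and $\Delta$ at every depth).
   Context: Simply typed constructors $c,d,e$, variables $x,y,z$, metavariables, recursion constants $\underline r,\underline s,\underline t$; $\bar x$ a list of distinct variables, $[\bar y/\bar x]$ renaming, terms $\beta$-normal $\eta$-long except that arguments of metavariables and recursion constants are bare variables; $h$ ranges over constructors and variables. Concrete: $T ::= \lambda\bar x.\,h\,\overline T\mid\lambda\bar x.\,H\,\bar y\mid\lambda\bar x.\,\underline r\,\bar y$; $\Delta_c$ a finite list of equations $T_1\doteq T_2$ and closed definitions $\underline r=_d\lambda\bar x.\,h\,\overline T$. Flattened: $U ::= \lambda\bar x.\,y\,\overline N\mid\lambda\bar x.\,c\,\overline N\mid\lambda\bar x.\,H^{\mathrm{con}}\bar y$; $N ::= \lambda\bar x.\,\underline r\,\bar y\mid\lambda\bar x.\,H^{\mathrm{rec}}\bar y$; $\Delta$ a finite collection of equations $U_1\doteq U_2$, $N_1\doteq N_2$, closed definitions $\underline r=_dU$, possibly $\mathrm{contra}$; unions rename recursion constants apart. Expansion: $\mathrm{exp}_0=\bot$;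 $\mathrm{exp}_{k+1}(\lambda\bar x.\,h\,T_1\cdots T_n)=\lambda\bar x.\,h\,(\mathrm{exp}_k(T_1))\cdots(\mathrm{exp}_k(T_n))$; concrete $\mathrm{exp}_{k+1}(\lambda\bar x.\,H\bar y)=\lambda\bar x.\,H^{\mathrm{rec}}\bar y$; flattened $\mathrm{exp}_{k+1}(\lambda\bar x.\,H^m\bar y)=\lambda\bar x.\,H^m\bar y$; $\mathrm{exp}_{k+1}(\lambda\bar x.\,\underline r\,\bar y)=\mathrm{exp}_{k+1}(\lambda\bar x.\,[\bar y/\bar z]B)$ where $\underline r=_d\lambda\bar z.\,B$ in the context. Translation: $\lambda\bar x.\,H\bar y\rhd^{\mathrm{rec}}\lambda\bar x.\,H^{\mathrm{rec}}\bar y\diamond[\,]$; $\lambda\bar x.\,\underline r\,\bar y\rhd^{\mathrm{rec}}\lambda\bar x.\,\underline r\,\bar y\diamond[\,]$; if $h\,\overline T\rhd^{\mathrm{con}}U\diamond\Delta$ and $\bar z=FV(h\,\overline T)$ then $\lambda\bar x.\,h\,\overline T\rhd^{\mathrm{rec}}\lambda\bar x.\,\underline r\,\bar z\diamond(\Delta,\underline r=_d\lambda\bar z.\,U)$, $\underline r$ fresh; if $T_i\rhd^{\mathrm{rec}}N_i\diamond\Delta_i$ for all $i$ then $\lambda\bar x.\,h\,T_1\cdots T_n\rhd^{\mathrm{con}}\lambda\bar x.\,h\,N_1\cdots N_n\diamond(\Delta_1,\dots,\Delta_n)$. Contexts: $[\,]\rhd[\,]$; if $\Delta_c\rhd\Delta_1$,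 $T_1\rhd^{\mathrm{rec}}N_1\diamond\Delta_2$, $T_2\rhd^{\mathrm{rec}}N_2\diamond\Delta_3$ then $(\Delta_c,T_1\doteq T_2)\rhd(\Delta_1,\Delta_2,\Delta_3,N_1\doteq N_2)$; if $\Delta_c\rhd\Delta_1$ and $\lambda\bar x.\,h\,\overline T\rhd^{\mathrm{con}}U\diamond\Delta_2$ then $(\Delta_c,\underline r=_d\lambda\bar x.\,h\,\overline T)\rhd(\Delta_1,\Delta_2,\underline r=_dU)$. -}

module Defs where

open import Data.Nat using (ℕ; zero; suc; _+_; _≟_)
open import Data.Fin using (Fin; _↑ˡ_; _↑ʳ_; splitAt; cast)
open import Data.Sum using (inj₁; inj₂)
open import Data.List using (List; []; _∷_; _++_; _∷ʳ_; map; length; lookup)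
open import Data.List.Membership.Propositional using (_∈_)
open import Data.List.Relation.Unary.Any using (Any)
open import Data.List.Relation.Unary.All using (All)
open import Data.List.Relation.Unary.Unique.Propositional using (Unique)
open import Data.Maybe using (Maybe; just; nothing)
open import Data.Product using (Σ; _×_; _,_)
open import Relation.Nullary using (¬_; yes; no)
open import Relation.Binary.PropositionalEquality using (_≡_; sym)

-- Bound/free variables are
-- (well-scoped) de Bruijn indices: a term of type  Tm n  lives in a
-- scope of n variables;  λx̄ with |x̄| = k  adds k new variables, which
-- are the first k indices of  Fin (k + n).

Con   = ℕ
MVar  = ℕ
RName = ℕ

data Head (n : ℕ) : Set where
  var : Fin n → Head n
  con : Con → Head n

-- Concrete terms  T ::= λx̄. h T̄ | λx̄. H ȳ | λx̄. r ȳ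

data Tm (n : ℕ) : Set
data Body (n : ℕ) : Set

data Tm n where
  lam : (k : ℕ) → Body (k + n) → Tm n

data Body n where
  app : Head n → List (Tm n) → Body n
  mv  : MVar → List (Fin n) → Body n
  rc  : RName → List (Fin n) → Body n

-- Concrete context entries: equations T₁ ≐ T₂ (in some scope n) and
-- closed definitions  r =_d λz̄. h T̄  (|z̄| = m, body in scope m).
data CEntry : Set where
  ceq  : (n : ℕ) → Tm n → Tm n → CEntry
  cdef : RName → (m : ℕ) → Head m → List (Tm m) → CEntry

CCtx = List CEntry

-- Flattened terms
--   U ::= λx̄. y N̄ | λx̄. c N̄ | λx̄. H^con ȳ
--   N ::= λx̄. r ȳ | λx̄. H^rec ȳ

data FN (n : ℕ) : Set where
  nrec  : (k : ℕ) → RName → List (Fin (k + n)) → FN n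
  nmeta : (k : ℕ) → MVar → List (Fin (k + n)) → FN n

data UBody (n : ℕ) : Set where
  appH : Head n → List (FN n) → UBody n
  mcon : MVar → List (Fin n) → UBody n

data FU (n : ℕ) : Set where
  u : (k : ℕ) → UBody (k + n) → FU n

data FEntry : Set where
  eqU    : (n : ℕ) → FU n → FU n → FEntry
  eqN    : (n : ℕ) → FN n → FN n → FEntry
  fdef   : RName → (m : ℕ) → UBody m → FEntry
  contra : FEntry

FCtx = List FEntry

lift : ∀ {n m} (k : ℕ) → (Fin n → Fin m) → Fin (k + n) → Fin (k + m)
lift {n} {m} k σ i with splitAt k i
... | inj₁ a = a ↑ˡ m
... | inj₂ b = k ↑ʳ σ b

renH : ∀ {n m} → (Fin n → Fin m) → Head n → Head m
renH σ (var x) = var (σ x)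
renH σ (con c) = con c

renT  : ∀ {n m} → (Fin n → Fin m) → Tm n → Tm m
renB  : ∀ {n m} → (Fin n → Fin m) → Body n → Body m
renTs : ∀ {n m} → (Fin n → Fin m) → List (Tm n) → List (Tm m)

renT σ (lam k b) = lam k (renB (lift k σ) b)
renB σ (app h ts) = app (renH σ h) (renTs σ ts)
renB σ (mv H ys)  = mv H (map σ ys)
renB σ (rc r ys)  = rc r (map σ ys)
renTs σ []       = []
renTs σ (t ∷ ts) = renT σ t ∷ renTs σ ts

renN : ∀ {n m} → (Fin n → Fin m) → FN n → FN m
renN σ (nrec k r ys)  = nrec k r (map (lift k σ) ys)
renN σ (nmeta k H ys) = nmeta k H (map (lift k σ) ys)

renUB : ∀ {n m} → (Fin n → Fin m) → UBody n → UBody m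
renUB σ (appH h ns) = appH (renH σ h) (map (renN σ) ns)
renUB σ (mcon H ys) = mcon H (map σ ys)

inst : ∀ {m n} (ys : List (Fin n)) → length ys ≡ m → Fin m → Fin n
inst ys p i = lookup ys (cast (sym p) i)

-- Expanded terms (results of exp_k): ⊥, λx̄. h E̅, λx̄. H^mode ȳ

data Mode : Set where
  conM recM : Mode

data ETm (n : ℕ) : Set
data EBody (n : ℕ) : Set

data ETm n where
  bot : ETm n
  lam : (k : ℕ) → EBody (k + n) → ETm n

data EBody n where
  app : Head n → List (ETm n) → EBody n
  mv  : Mode → MVar → List (Fin n) → EBody n

lookupC : RName → CCtx → Maybe (Σ ℕ λ m → Head m × List (Tm m))
lookupC r [] = nothing
lookupC r (ceq _ _ _ ∷ Γ) = lookupC r Γ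
lookupC r (cdef s m h ts ∷ Γ) with r ≟ s
... | yes _ = just (m , h , ts)
... | no  _ = lookupC r Γ

lookupF : RName → FCtx → Maybe (Σ ℕ UBody)
lookupF r [] = nothing
lookupF r (fdef s m B ∷ Γ) with r ≟ s
... | yes _ = just (m , B)
... | no  _ = lookupF r Γ
lookupF r (eqU _ _ _ ∷ Γ) = lookupF r Γ
lookupF r (eqN _ _ _ ∷ Γ) = lookupF r Γ
lookupF r (contra ∷ Γ)    = lookupF r Γ

-- Expansion  exp^Γ_k.  (Undefined recursion constants and arity
-- mismatches, impossible for well-typed closed contexts, give ⊥.)

expC : ∀ {n} → CCtx → ℕ → Tm n → ETm n
unfoldC : ∀ {n} → CCtx → ℕ → (k : ℕ) → List (Fin (k + n))
        → Maybe (Σ ℕ λ m → Head m × List (Tm m)) → ETm n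

expC Γ zero t = bot
expC Γ (suc j) (lam k (app h ts)) = lam k (app h (map (expC Γ j) ts))
expC Γ (suc j) (lam k (mv H ys))  = lam k (mv recM H ys)
expC Γ (suc j) (lam k (rc r ys))  = unfoldC Γ j k ys (lookupC r Γ)

unfoldC Γ j k ys nothing = bot
unfoldC Γ j k ys (just (m , h , ts)) with length ys ≟ m
... | no  _ = bot
... | yes p = lam k (app (renH (inst ys p) h) (map (expC Γ j) (renTs (inst ys p) ts)))

expN : ∀ {n} → FCtx → ℕ → FN n → ETm n
unfoldF : ∀ {n} → FCtx → ℕ → (k : ℕ) → List (Fin (k + n))
        → Maybe (Σ ℕ UBody) → ETm n

expN Γ zero t = bot
expN Γ (suc j) (nmeta k H ys) = lam k (mv recM H ys)
expN Γ (suc j) (nrec k r ys)  = unfoldF Γ j k ys (lookupF r Γ)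

unfoldF Γ j k ys nothing = bot
unfoldF Γ j k ys (just (m , B)) with length ys ≟ m
... | no  _ = bot
unfoldF Γ j k ys (just (m , appH h ns)) | yes p =
  lam k (app (renH (inst ys p) h) (map (expN Γ j) (map (renN (inst ys p)) ns)))
unfoldF Γ j k ys (just (m , mcon H ws)) | yes p =
  lam k (mv conM H (map (inst ys p) ws))

expU : ∀ {n} → FCtx → ℕ → FU n → ETm n
expU Γ zero t = bot
expU Γ (suc j) (u k (appH h ns)) = lam k (app h (map (expN Γ j) ns))
expU Γ (suc j) (u k (mcon H ys)) = lam k (mv conM H ys)

data OccT {n : ℕ} (i : Fin n) : Tm n → Set
data OccB {n : ℕ} (i : Fin n) : Body n → Set

data OccT {n} i where
  lam : ∀ {k b} → OccB (k ↑ʳ i) b → OccT i (lam k b)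

data OccB {n} i where
  head : ∀ {ts} → OccB i (app (var i) ts)
  arg  : ∀ {h ts t} → t ∈ ts → OccT i t → OccB i (app h ts)
  mv   : ∀ {H ys} → i ∈ ys → OccB i (mv H ys)
  rc   : ∀ {r ys} → i ∈ ys → OccB i (rc r ys)

data RinT (r : RName) {n : ℕ} : Tm n → Set
data RinB (r : RName) {n : ℕ} : Body n → Set

data RinT r {n} where
  lam : ∀ {k b} → RinB r b → RinT r (lam k b)

data RinB r {n} where
  rc  : ∀ {ys} → RinB r (rc r ys)
  arg : ∀ {h ts t} → t ∈ ts → RinT r t → RinB r (app h ts)

data RinE (r : RName) : CEntry → Set where
  eqL  : ∀ {n T₁ T₂} → RinT r T₁ → RinE r (ceq n T₁ T₂)
  eqR  : ∀ {n T₁ T₂} → RinT r T₂ → RinE r (ceq n T₁ T₂)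
  defL : ∀ {m h ts} → RinE r (cdef r m h ts)
  defB : ∀ {s m h ts t} → t ∈ ts → RinT r t → RinE r (cdef s m h ts)

-- Each judgement also records the list G of recursion
-- constants freshly generated in it; freshness (and "unions rename
-- recursion constants apart") is imposed globally in _▷_ below.

data _▷rec_◇_∣_ {n : ℕ} : Tm n → FN n → FCtx → List RName → Set
data _▷recs_◇_∣_ {n : ℕ} : List (Tm n) → List (FN n) → FCtx → List RName → Set
data _▷con_◇_∣_ {n : ℕ} : Body n → UBody n → FCtx → List RName → Set

data _▷rec_◇_∣_ {n} where
  meta : ∀ {k H ys} → lam k (mv H ys) ▷rec nmeta k H ys ◇ [] ∣ []
  recc : ∀ {k r ys} → lam k (rc r ys) ▷rec nrec k r ys ◇ [] ∣ []
  -- λx̄. h T̄ ▷rec λx̄. r z̄ ◇ (Δ, r =_d λz̄. U)   where h T̄ ▷con U ◇ Δ,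
  -- z̄ = FV(h T̄) (a duplicate-free enumeration), and λz̄. U is U
  -- expressed over z̄ (U = [z̄] U').
  gen  : ∀ {k} {h : Head (k + n)} {ts U Δ G}
         (r : RName) (zs : List (Fin (k + n))) (U' : UBody (length zs)) →
         Unique zs →
         (∀ i → (i ∈ zs → OccB i (app h ts)) × (OccB i (app h ts) → i ∈ zs)) →
         app h ts ▷con U ◇ Δ ∣ G →
         renUB (inst zs _≡_.refl) U' ≡ U →
         lam k (app h ts) ▷rec nrec k r zs ◇ (Δ ∷ʳ fdef r (length zs) U') ∣ (G ∷ʳ r)

data _▷recs_◇_∣_ {n} where
  []  : [] ▷recs [] ◇ [] ∣ []
  _∷_ : ∀ {T Ts N Ns Δ Δs G Gs} →
        T ▷rec N ◇ Δ ∣ G → Ts ▷recs Ns ◇ Δs ∣ Gs →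
        (T ∷ Ts) ▷recs (N ∷ Ns) ◇ (Δ ++ Δs) ∣ (G ++ Gs)

data _▷con_◇_∣_ {n} where
  app : ∀ {h ts ns Δ G} → ts ▷recs ns ◇ Δ ∣ G → app h ts ▷con appH h ns ◇ Δ ∣ G

data _▷ctx_∣_ : CCtx → FCtx → List RName → Set where
  []   : [] ▷ctx [] ∣ []
  eq   : ∀ {Δc Δ₁ Δ₂ Δ₃ G₁ G₂ G₃ n} {T₁ T₂ : Tm n} {N₁ N₂} →
         Δc ▷ctx Δ₁ ∣ G₁ → T₁ ▷rec N₁ ◇ Δ₂ ∣ G₂ → T₂ ▷rec N₂ ◇ Δ₃ ∣ G₃ →
         (Δc ∷ʳ ceq n T₁ T₂) ▷ctx ((Δ₁ ++ Δ₂ ++ Δ₃) ∷ʳ eqN n N₁ N₂) ∣ (G₁ ++ G₂ ++ G₃)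
  def  : ∀ {Δc Δ₁ Δ₂ G₁ G₂ r m} {h : Head m} {ts U} →
         Δc ▷ctx Δ₁ ∣ G₁ → app h ts ▷con U ◇ Δ₂ ∣ G₂ →
         (Δc ∷ʳ cdef r m h ts) ▷ctx ((Δ₁ ++ Δ₂) ∷ʳ fdef r m U) ∣ (G₁ ++ G₂)

_▷_ : CCtx → FCtx → Set
Δc ▷ Δ = Σ (List RName) λ G →
  (Δc ▷ctx Δ ∣ G) × Unique G × All (λ r → ¬ Any (RinE r) Δc) G

-- Away from the constants it generates, the translation keeps definition
-- lookups in step: a recursion constant of Δc is defined in Δ exactly when it
-- is defined in Δc, and then by the flattening of the same body, while each
-- generated constant is defined by the flattened subterm it abstracts.  As the
-- generated names are pairwise distinct and fresh for Δc, the first definition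
-- found by lookup is always the intended one.  Given this invariant, expansion
-- commutes with translation by induction on the depth, generalised over
-- renamings since unfolding a definition instantiates its parameters.
module Submission where

open import Defs
open import Data.Nat using (ℕ; zero; suc; _+_; _≟_; pred)
open import Data.Fin using (Fin; zero; suc; _↑ʳ_; splitAt)
open import Data.Fin.Properties using (splitAt-↑ˡ; splitAt-↑ʳ; join-splitAt)
open import Data.Sum using (inj₁; inj₂)
open import Data.List using (List; []; _∷_; _++_; _∷ʳ_; map; length)
open import Data.List.Properties using (length-map; map-cong; map-∘; map-id)
open import Data.List.Membership.Propositional using (_∈_; _∉_; lose)
open import Data.List.Membership.Propositional.Properties using (∈-++⁺ˡ; ∈-++⁺ʳ; ∈-++⁻)
open import Data.List.Relation.Unary.Any using (Any; here; there)
import Data.List.Relation.Unary.Any.Properties as Any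
open import Data.List.Relation.Unary.All as All using (All; []; _∷_)
import Data.List.Relation.Unary.All.Properties as All
open import Data.List.Relation.Unary.AllPairs using ([]; _∷_)
open import Data.List.Relation.Unary.Unique.Propositional using (Unique)
open import Data.List.Relation.Binary.Disjoint.Propositional using (Disjoint)
open import Data.Maybe using (just; nothing; _<∣>_)
open import Data.Product using (Σ; ∃; _×_; _,_)
open import Data.Unit using (⊤; tt)
open import Data.Empty using (⊥-elim)
open import Function using (id; _∘_)
open import Relation.Nullary using (¬_; yes; no)
open import Relation.Binary.PropositionalEquality

unique-++⁻ : ∀ {A : Set} (xs : List A) {ys} →
             Unique (xs ++ ys) → Unique xs × Unique ys × Disjoint xs ys
unique-++⁻ []       uniq = [] , uniq , λ { (() , _) }
unique-++⁻ (x ∷ xs) (x∉ ∷ uniq) with unique-++⁻ xs uniq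
... | uxs , uys , xs#ys = All.++⁻ˡ xs x∉ ∷ uxs , uys , λ where
  (here refl , y∈) → All.lookup x∉ (∈-++⁺ʳ xs y∈) refl
  (there x∈  , y∈) → xs#ys (x∈ , y∈)

lift-cong : ∀ {n m} k {f g : Fin n → Fin m} → f ≗ g → lift k f ≗ lift k g
lift-cong k f≗g i with splitAt k i
... | inj₁ a = refl
... | inj₂ b = cong (k ↑ʳ_) (f≗g b)

lift-∘ : ∀ {n m p} k (f : Fin m → Fin p) (g : Fin n → Fin m) →
         lift k f ∘ lift k g ≗ lift k (f ∘ g)
lift-∘ {m = m} k f g i with splitAt k i
... | inj₁ a rewrite splitAt-↑ˡ k a m     = refl
... | inj₂ b rewrite splitAt-↑ʳ k m (g b) = refl

lift-id : ∀ {n} k {f : Fin n → Fin n} → f ≗ id → lift k f ≗ id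
lift-id {n} k f≗id i with splitAt k i | join-splitAt k n i
... | inj₁ a | i≡ = i≡
... | inj₂ b | i≡ = trans (cong (k ↑ʳ_) (f≗id b)) i≡

renH-id : ∀ {n} {f : Fin n → Fin n} → f ≗ id → renH f ≗ id
renH-id f≗id (var x) = cong var (f≗id x)
renH-id f≗id (con c) = refl

renT-id  : ∀ {n} {f : Fin n → Fin n} → f ≗ id → renT f ≗ id
renB-id  : ∀ {n} {f : Fin n → Fin n} → f ≗ id → renB f ≗ id
renTs-id : ∀ {n} {f : Fin n → Fin n} → f ≗ id → renTs f ≗ id
renT-id f≗id (lam k b) = cong (lam k) (renB-id (lift-id k f≗id) b)
renB-id f≗id (app h ts) = cong₂ app (renH-id f≗id h) (renTs-id f≗id ts)
renB-id f≗id (mv H ys)  = cong (mv H) (trans (map-cong f≗id ys) (map-id ys))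
renB-id f≗id (rc r ys)  = cong (rc r) (trans (map-cong f≗id ys) (map-id ys))
renTs-id f≗id []       = refl
renTs-id f≗id (t ∷ ts) = cong₂ _∷_ (renT-id f≗id t) (renTs-id f≗id ts)

renN-id : ∀ {n} {f : Fin n → Fin n} → f ≗ id → renN f ≗ id
renN-id f≗id (nrec k r ys)  = cong (nrec k r) (trans (map-cong (lift-id k f≗id) ys) (map-id ys))
renN-id f≗id (nmeta k H ys) = cong (nmeta k H) (trans (map-cong (lift-id k f≗id) ys) (map-id ys))

renN-cong : ∀ {n m} {f g : Fin n → Fin m} → f ≗ g → renN f ≗ renN g
renN-cong f≗g (nrec k r ys)  = cong (nrec k r) (map-cong (lift-cong k f≗g) ys)
renN-cong f≗g (nmeta k H ys) = cong (nmeta k H) (map-cong (lift-cong k f≗g) ys)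

renN-∘ : ∀ {n m p} (f : Fin m → Fin p) (g : Fin n → Fin m) → renN f ∘ renN g ≗ renN (f ∘ g)
renN-∘ f g (nrec k r ys)  = cong (nrec k r) (trans (sym (map-∘ ys)) (map-cong (lift-∘ k f g) ys))
renN-∘ f g (nmeta k H ys) = cong (nmeta k H) (trans (sym (map-∘ ys)) (map-cong (lift-∘ k f g) ys))

inst-map : ∀ {n m l} (σ : Fin n → Fin m) (zs : List (Fin n))
           (p : length (map σ zs) ≡ l) (q : length zs ≡ l) →
           inst (map σ zs) p ≗ σ ∘ inst zs q
inst-map {l = zero}  σ []       p q  ()
inst-map {l = suc l} σ []       p () i
inst-map {l = zero}  σ (z ∷ zs) p () i
inst-map {l = suc l} σ (z ∷ zs) p q  zero    = refl
inst-map {l = suc l} σ (z ∷ zs) p q  (suc i) = inst-map σ zs (cong pred p) (cong pred q) i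

renH-inst-map : ∀ {n m} (σ : Fin n → Fin m) (zs : List (Fin n))
                (p : length (map σ zs) ≡ length zs) →
                renH σ ∘ renH (inst zs refl) ≗ renH (inst (map σ zs) p)
renH-inst-map σ zs p (var x) = cong var (sym (inst-map σ zs p refl x))
renH-inst-map σ zs p (con c) = refl

renN-inst-map : ∀ {n m} (σ : Fin n → Fin m) (zs : List (Fin n))
                (p : length (map σ zs) ≡ length zs) →
                renN σ ∘ renN (inst zs refl) ≗ renN (inst (map σ zs) p)
renN-inst-map σ zs p N =
  trans (renN-∘ σ (inst zs refl) N) (renN-cong (sym ∘ inst-map σ zs p refl) N)

lookupF-++ : ∀ r (Γ : FCtx) {Γ′} → lookupF r (Γ ++ Γ′) ≡ (lookupF r Γ <∣> lookupF r Γ′)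
lookupF-++ r [] = refl
lookupF-++ r (fdef s m B ∷ Γ) with r ≟ s
... | yes _ = refl
... | no  _ = lookupF-++ r Γ
lookupF-++ r (eqU _ _ _ ∷ Γ) = lookupF-++ r Γ
lookupF-++ r (eqN _ _ _ ∷ Γ) = lookupF-++ r Γ
lookupF-++ r (contra ∷ Γ)    = lookupF-++ r Γ

lookupC-++ : ∀ r (Γ : CCtx) {Γ′} → lookupC r (Γ ++ Γ′) ≡ (lookupC r Γ <∣> lookupC r Γ′)
lookupC-++ r [] = refl
lookupC-++ r (cdef s m h ts ∷ Γ) with r ≟ s
... | yes _ = refl
... | no  _ = lookupC-++ r Γ
lookupC-++ r (ceq _ _ _ ∷ Γ) = lookupC-++ r Γ

lookupF-++ˡ : ∀ {r x} Γ {Γ′} → lookupF r Γ ≡ just x → lookupF r (Γ ++ Γ′) ≡ just x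
lookupF-++ˡ {r} Γ {Γ′} e = trans (lookupF-++ r Γ) (cong (_<∣> lookupF r Γ′) e)

lookupF-++ʳ : ∀ {r} Γ {Γ′} → lookupF r Γ ≡ nothing → lookupF r (Γ ++ Γ′) ≡ lookupF r Γ′
lookupF-++ʳ {r} Γ {Γ′} e = trans (lookupF-++ r Γ) (cong (_<∣> lookupF r Γ′) e)

lookupC-++ˡ : ∀ {r x} Γ {Γ′} → lookupC r Γ ≡ just x → lookupC r (Γ ++ Γ′) ≡ just x
lookupC-++ˡ {r} Γ {Γ′} e = trans (lookupC-++ r Γ) (cong (_<∣> lookupC r Γ′) e)

lookupC-++ʳ : ∀ {r} Γ {Γ′} → lookupC r Γ ≡ nothing → lookupC r (Γ ++ Γ′) ≡ lookupC r Γ′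
lookupC-++ʳ {r} Γ {Γ′} e = trans (lookupC-++ r Γ) (cong (_<∣> lookupC r Γ′) e)

lookupF-here : ∀ r m B Γ → lookupF r (fdef r m B ∷ Γ) ≡ just (m , B)
lookupF-here r m B Γ with r ≟ r
... | yes _  = refl
... | no r≢r = ⊥-elim (r≢r refl)

lookupF-there : ∀ {r s} m B Γ → r ≢ s → lookupF r (fdef s m B ∷ Γ) ≡ lookupF r Γ
lookupF-there {r} {s} m B Γ r≢s with r ≟ s
... | yes r≡s = ⊥-elim (r≢s r≡s)
... | no  _   = refl

lookupC-here : ∀ r m h ts Γ → lookupC r (cdef r m h ts ∷ Γ) ≡ just (m , h , ts)
lookupC-here r m h ts Γ with r ≟ r
... | yes _  = refl
... | no r≢r = ⊥-elim (r≢r refl)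

lookupC-there : ∀ {r s} m h ts Γ → r ≢ s → lookupC r (cdef s m h ts ∷ Γ) ≡ lookupC r Γ
lookupC-there {r} {s} m h ts Γ r≢s with r ≟ s
... | yes r≡s = ⊥-elim (r≢s r≡s)
... | no  _   = refl

lookupC-∈ : ∀ {r m h ts} Γ → lookupC r Γ ≡ just (m , h , ts) → cdef r m h ts ∈ Γ
lookupC-∈ {r} (cdef s m h ts ∷ Γ) e with r ≟ s
lookupC-∈ (cdef s m h ts ∷ Γ) refl | yes refl = here refl
... | no _ = there (lookupC-∈ Γ e)
lookupC-∈ (ceq _ _ _ ∷ Γ) e = there (lookupC-∈ Γ e)

lookupC-unmentioned : ∀ {r} Γ → ¬ Any (RinE r) Γ → lookupC r Γ ≡ nothing
lookupC-unmentioned [] _ = refl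
lookupC-unmentioned (ceq _ _ _ ∷ Γ) ¬r∈ = lookupC-unmentioned Γ (¬r∈ ∘ there)
lookupC-unmentioned {r} (cdef s m h ts ∷ Γ) ¬r∈ with r ≟ s
... | yes refl = ⊥-elim (¬r∈ (here defL))
... | no  _    = lookupC-unmentioned Γ (¬r∈ ∘ there)

lookupF-∉-generated  : ∀ {n r} {T : Tm n} {N Δ′ G′} →
                       T ▷rec N ◇ Δ′ ∣ G′ → r ∉ G′ → lookupF r Δ′ ≡ nothing
lookupF-∉-generated* : ∀ {n r} {Ts : List (Tm n)} {Ns Δ′ G′} →
                       Ts ▷recs Ns ◇ Δ′ ∣ G′ → r ∉ G′ → lookupF r Δ′ ≡ nothing
lookupF-∉-generated meta _ = refl
lookupF-∉-generated recc _ = refl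
lookupF-∉-generated (gen {Δ = Δs} {G = Gs} r zs U′ _ _ (app ds) _) r′∉ =
  trans (lookupF-++ʳ Δs (lookupF-∉-generated* ds (r′∉ ∘ ∈-++⁺ˡ)))
        (lookupF-there (length zs) U′ [] (r′∉ ∘ ∈-++⁺ʳ Gs ∘ here))
lookupF-∉-generated* [] _ = refl
lookupF-∉-generated* (_∷_ {Δ = Δ₁} {G = G₁} d ds) r∉ =
  trans (lookupF-++ʳ Δ₁ (lookupF-∉-generated d (r∉ ∘ ∈-++⁺ˡ)))
        (lookupF-∉-generated* ds (r∉ ∘ ∈-++⁺ʳ G₁))

Registered  : ∀ {n} {T : Tm n} {N Δ′ G′} → FCtx → T ▷rec N ◇ Δ′ ∣ G′ → Set
Registered* : ∀ {n} {Ts : List (Tm n)} {Ns Δ′ G′} → FCtx → Ts ▷recs Ns ◇ Δ′ ∣ G′ → Set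
Registered Δ meta = ⊤
Registered Δ recc = ⊤
Registered Δ (gen r zs U′ _ _ (app ds) _) = lookupF r Δ ≡ just (length zs , U′) × Registered* Δ ds
Registered* Δ [] = ⊤
Registered* Δ (d ∷ ds) = Registered Δ d × Registered* Δ ds

record _≼_ (Δ Δ′ : FCtx) : Set where
  field
    members : ∀ {e} → e ∈ Δ → e ∈ Δ′
    lookups : ∀ {r x} → lookupF r Δ ≡ just x → lookupF r Δ′ ≡ just x
open _≼_

≼-++ʳ : ∀ Δ {X} → Δ ≼ (Δ ++ X)
≼-++ʳ Δ = record { members = ∈-++⁺ˡ ; lookups = lookupF-++ˡ Δ }

≼-trans : ∀ {Δ₁ Δ₂ Δ₃} → Δ₁ ≼ Δ₂ → Δ₂ ≼ Δ₃ → Δ₁ ≼ Δ₃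
≼-trans p q = record { members = members q ∘ members p ; lookups = lookups q ∘ lookups p }

registered-mono  : ∀ {n} {T : Tm n} {N Δ′ G′ Δ Δ⁺} → Δ ≼ Δ⁺ →
                   (d : T ▷rec N ◇ Δ′ ∣ G′) → Registered Δ d → Registered Δ⁺ d
registered*-mono : ∀ {n} {Ts : List (Tm n)} {Ns Δ′ G′ Δ Δ⁺} → Δ ≼ Δ⁺ →
                   (ds : Ts ▷recs Ns ◇ Δ′ ∣ G′) → Registered* Δ ds → Registered* Δ⁺ ds
registered-mono Δ≼ meta _ = tt
registered-mono Δ≼ recc _ = tt
registered-mono Δ≼ (gen r zs U′ _ _ (app ds) _) (e , reg) = lookups Δ≼ e , registered*-mono Δ≼ ds reg
registered*-mono Δ≼ [] _ = tt
registered*-mono Δ≼ (d ∷ ds) (reg , regs) = registered-mono Δ≼ d reg , registered*-mono Δ≼ ds regs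

registered-++ˡ  : ∀ {n} {T : Tm n} {N Δ′ G′ Δ} Y (d : T ▷rec N ◇ Δ′ ∣ G′) →
                  (∀ {s} → s ∈ G′ → lookupF s Y ≡ nothing) → Registered Δ d → Registered (Y ++ Δ) d
registered*-++ˡ : ∀ {n} {Ts : List (Tm n)} {Ns Δ′ G′ Δ} Y (ds : Ts ▷recs Ns ◇ Δ′ ∣ G′) →
                  (∀ {s} → s ∈ G′ → lookupF s Y ≡ nothing) → Registered* Δ ds → Registered* (Y ++ Δ) ds
registered-++ˡ Y meta _ _ = tt
registered-++ˡ Y recc _ _ = tt
registered-++ˡ Y (gen {G = Gs} r zs U′ _ _ (app ds) _) Y∌ (e , reg) =
  trans (lookupF-++ʳ Y (Y∌ (∈-++⁺ʳ Gs (here refl)))) e ,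
  registered*-++ˡ Y ds (Y∌ ∘ ∈-++⁺ˡ) reg
registered*-++ˡ Y [] _ _ = tt
registered*-++ˡ Y (_∷_ {G = G₁} d ds) Y∌ (reg , regs) =
  registered-++ˡ Y d (Y∌ ∘ ∈-++⁺ˡ) reg , registered*-++ˡ Y ds (Y∌ ∘ ∈-++⁺ʳ G₁) regs

registered-own  : ∀ {n} {T : Tm n} {N Δ′ G′} (d : T ▷rec N ◇ Δ′ ∣ G′) →
                  Unique G′ → Registered Δ′ d
registered*-own : ∀ {n} {Ts : List (Tm n)} {Ns Δ′ G′} (ds : Ts ▷recs Ns ◇ Δ′ ∣ G′) →
                  Unique G′ → Registered* Δ′ ds
registered-own meta _ = tt
registered-own recc _ = tt
registered-own (gen {Δ = Δs} {G = Gs} r zs U′ _ _ (app ds) _) uniq with unique-++⁻ Gs uniq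
... | uGs , _ , Gs#r =
  trans (lookupF-++ʳ Δs (lookupF-∉-generated* ds λ r∈ → Gs#r (r∈ , here refl)))
        (lookupF-here r (length zs) U′ []) ,
  registered*-mono (≼-++ʳ Δs) ds (registered*-own ds uGs)
registered*-own [] _ = tt
registered*-own (_∷_ {Δ = Δ₁} {G = G₁} d ds) uniq with unique-++⁻ G₁ uniq
... | u₁ , u₂ , G₁#G₂ =
  registered-mono (≼-++ʳ Δ₁) d (registered-own d u₁) ,
  registered*-++ˡ Δ₁ ds (λ s∈ → lookupF-∉-generated d λ s∈₁ → G₁#G₂ (s∈₁ , s∈))
    (registered*-own ds u₂)

-- Expansion commutes with translation

data Agree (Δc : CCtx) (Δ : FCtx) (r : RName) : Set where
  undefined : lookupC r Δc ≡ nothing → lookupF r Δ ≡ nothing → Agree Δc Δ r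
  defined   : ∀ {m} {h : Head m} {ts ns Δ′ G′} (ds : ts ▷recs ns ◇ Δ′ ∣ G′) →
              lookupC r Δc ≡ just (m , h , ts) → lookupF r Δ ≡ just (m , appH h ns) →
              Registered* Δ ds → Agree Δc Δ r

MentionedIn : ∀ {n} → CCtx → Tm n → Set
MentionedIn Δc T = ∀ {r} → RinT r T → Any (RinE r) Δc

mentionedIn-args : ∀ {Δc n k} {h : Head (k + n)} {ts} →
                   MentionedIn Δc (lam k (app h ts)) → All (MentionedIn Δc) ts
mentionedIn-args men = All.tabulate λ t∈ o → men (lam (arg t∈ o))

mentionedIn-definition : ∀ {Δc r m} {h : Head m} {ts} →
                         lookupC r Δc ≡ just (m , h , ts) → All (MentionedIn Δc) ts
mentionedIn-definition {Δc} e = All.tabulate λ t∈ o → lose (lookupC-∈ Δc e) (defB t∈ o)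

unfoldF-appH : ∀ {n} Δ j k (ys : List (Fin (k + n))) {m} (h : Head m) ns (p : length ys ≡ m) →
               unfoldF Δ j k ys (just (m , appH h ns))
                 ≡ lam k (app (renH (inst ys p) h) (map (expN Δ j) (map (renN (inst ys p)) ns)))
unfoldF-appH Δ j k ys {m} h ns p with length ys ≟ m
... | yes _  = refl
... | no ¬p  = ⊥-elim (¬p p)

data Translated (Δ : FCtx) (n : ℕ) (T₁ T₂ : Tm n) : Set where
  translated : ∀ {N₁ N₂ Δ₁ G₁ Δ₂ G₂} → eqN n N₁ N₂ ∈ Δ →
               (d₁ : T₁ ▷rec N₁ ◇ Δ₁ ∣ G₁) (d₂ : T₂ ▷rec N₂ ◇ Δ₂ ∣ G₂) →
               Registered Δ d₁ → Registered Δ d₂ → Translated Δ n T₁ T₂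

module Expansion (Δc : CCtx) (Δ : FCtx) (agree : ∀ {r} → Any (RinE r) Δc → Agree Δc Δ r) where

  expC-renT  : ∀ j {n} {T : Tm n} {N Δ′ G′} (d : T ▷rec N ◇ Δ′ ∣ G′) → Registered Δ d →
               MentionedIn Δc T → ∀ {m} (σ : Fin n → Fin m) →
               expC Δc j (renT σ T) ≡ expN Δ j (renN σ N)
  expC-renTs : ∀ j {n} {Ts : List (Tm n)} {Ns Δ′ G′} (ds : Ts ▷recs Ns ◇ Δ′ ∣ G′) →
               Registered* Δ ds →
               All (MentionedIn Δc) Ts → ∀ {m} (σ : Fin n → Fin m) →
               map (expC Δc j) (renTs σ Ts) ≡ map (expN Δ j) (map (renN σ) Ns)
  unfold-agree : ∀ j {n} k (ys : List (Fin (k + n))) {r} → Any (RinE r) Δc →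
                 unfoldC Δc j k ys (lookupC r Δc) ≡ unfoldF Δ j k ys (lookupF r Δ)

  expC-renT zero d reg men σ = refl
  expC-renT (suc j) meta reg men σ = refl
  expC-renT (suc j) (recc {k = k} {ys = ys}) reg men σ = unfold-agree j k (map (lift k σ) ys) (men (lam rc))
  expC-renT (suc j) (gen r zs (mcon H ws) _ _ (app ds) ()) reg men σ
  expC-renT (suc j) (gen {k = k} {ts = ts} r zs (appH h ns) _ _ (app ds) refl) (e , reg) men σ = begin
      lam k (app (renH σ′ (renH (inst zs refl) h)) (map (expC Δc j) (renTs σ′ ts)))
    ≡⟨ cong₂ (λ h′ Es → lam k (app h′ Es)) (renH-inst-map σ′ zs p h) args ⟩
      lam k (app (renH (inst (map σ′ zs) p) h) (map (expN Δ j) (map (renN (inst (map σ′ zs) p)) ns)))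
    ≡⟨ sym (unfoldF-appH Δ j k (map σ′ zs) h ns p) ⟩
      unfoldF Δ j k (map σ′ zs) (just (length zs , appH h ns))
    ≡⟨ cong (unfoldF Δ j k (map σ′ zs)) (sym e) ⟩
      expN Δ (suc j) (renN σ (nrec k r zs)) ∎
    where
      open ≡-Reasoning
      σ′ = lift k σ
      p  = length-map σ′ zs
      args : map (expC Δc j) (renTs σ′ ts) ≡ map (expN Δ j) (map (renN (inst (map σ′ zs) p)) ns)
      args = trans (expC-renTs j ds reg (mentionedIn-args men) σ′)
                   (cong (map (expN Δ j)) (trans (sym (map-∘ ns)) (map-cong (renN-inst-map σ′ zs p) ns)))

  expC-renTs j [] _ _ σ = refl
  expC-renTs j (d ∷ ds) (reg , regs) (men ∷ mens) σ =
    cong₂ _∷_ (expC-renT j d reg men σ) (expC-renTs j ds regs mens σ)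

  unfold-agree j k ys r∈ with agree r∈
  ... | undefined c f rewrite c | f = refl
  ... | defined {m} ds c f reg rewrite c | f with length ys ≟ m
  ...   | no  _ = refl
  ...   | yes p = cong (λ Es → lam k (app _ Es)) (expC-renTs j ds reg (mentionedIn-definition c) (inst ys p))

  expC≡expN : ∀ k {n} {T : Tm n} {N Δ′ G′} (d : T ▷rec N ◇ Δ′ ∣ G′) → Registered Δ d →
              MentionedIn Δc T → expC Δc k T ≡ expN Δ k N
  expC≡expN k {T = T} {N} d reg men = begin
    expC Δc k T           ≡⟨ cong (expC Δc k) (sym (renT-id (λ _ → refl) T)) ⟩
    expC Δc k (renT id T) ≡⟨ expC-renT k d reg men id ⟩
    expN Δ k (renN id N)  ≡⟨ cong (expN Δ k) (renN-id (λ _ → refl) N) ⟩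
    expN Δ k N            ∎
    where open ≡-Reasoning

  expC-rc≡expN-nrec : ∀ k {n} l (ys : List (Fin (l + n))) {r} → Any (RinE r) Δc →
                      expC Δc k (lam l (rc r ys)) ≡ expN Δ k (nrec l r ys)
  expC-rc≡expN-nrec zero    l ys r∈ = refl
  expC-rc≡expN-nrec (suc j) l ys r∈ = unfold-agree j l ys r∈

  translated-expansions : ∀ {n} {T₁ T₂ : Tm n} →
    MentionedIn Δc T₁ → MentionedIn Δc T₂ → Translated Δ n T₁ T₂ →
    Σ (FN n) λ N₁ → Σ (FN n) λ N₂ → (eqN n N₁ N₂ ∈ Δ) ×
      ((k : ℕ) → (expC Δc k T₁ ≡ expN Δ k N₁) × (expC Δc k T₂ ≡ expN Δ k N₂))
  translated-expansions men₁ men₂ (translated {N₁} {N₂} e∈ d₁ d₂ reg₁ reg₂) =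
    N₁ , N₂ , e∈ , λ k → expC≡expN k d₁ reg₁ men₁ , expC≡expN k d₂ reg₂ men₂

-- The invariant of context translation

agree-mono : ∀ {Δc Δc⁺ Δ Δ⁺ r} →
             (∀ {x} → lookupC r Δc ≡ just x → lookupC r Δc⁺ ≡ just x) → Δ ≼ Δ⁺ →
             (lookupC r Δc ≡ nothing → lookupF r Δ ≡ nothing → Agree Δc⁺ Δ⁺ r) →
             Agree Δc Δ r → Agree Δc⁺ Δ⁺ r
agree-mono _ _ new (undefined c f) = new c f
agree-mono Δc⊑ Δ≼ _ (defined ds c f reg) = defined ds (Δc⊑ c) (lookups Δ≼ f) (registered*-mono Δ≼ ds reg)

translated-mono : ∀ {Δ Δ⁺ n} {T₁ T₂ : Tm n} →
                  Δ ≼ Δ⁺ → Translated Δ n T₁ T₂ → Translated Δ⁺ n T₁ T₂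
translated-mono Δ≼ (translated e∈ d₁ d₂ reg₁ reg₂) =
  translated (members Δ≼ e∈) d₁ d₂ (registered-mono Δ≼ d₁ reg₁) (registered-mono Δ≼ d₂ reg₂)

translated-new : ∀ {Δ₂ Δ₃ G₂ G₃ n} {T₁ T₂ : Tm n} {N₁ N₂} Δ₁ →
                 (d₁ : T₁ ▷rec N₁ ◇ Δ₂ ∣ G₂) (d₂ : T₂ ▷rec N₂ ◇ Δ₃ ∣ G₃) →
                 Unique (G₂ ++ G₃) → (∀ {s} → s ∈ G₂ ++ G₃ → lookupF s Δ₁ ≡ nothing) →
                 Translated ((Δ₁ ++ Δ₂ ++ Δ₃) ∷ʳ eqN n N₁ N₂) n T₁ T₂
translated-new {Δ₂} {Δ₃} {G₂} Δ₁ d₁ d₂ u₂₃ Δ₁∌ with unique-++⁻ G₂ u₂₃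
... | u₂ , u₃ , G₂#G₃ =
  translated (∈-++⁺ʳ (Δ₁ ++ Δ₂ ++ Δ₃) (here refl)) d₁ d₂
    (registered-mono (≼-++ʳ (Δ₁ ++ Δ₂ ++ Δ₃)) d₁ (registered-++ˡ Δ₁ d₁ (Δ₁∌ ∘ ∈-++⁺ˡ)
      (registered-mono (≼-++ʳ Δ₂) d₁ (registered-own d₁ u₂))))
    (registered-mono (≼-++ʳ (Δ₁ ++ Δ₂ ++ Δ₃)) d₂ (registered-++ˡ Δ₁ d₂ (Δ₁∌ ∘ ∈-++⁺ʳ G₂)
      (registered-++ˡ Δ₂ d₂ (λ s∈ → lookupF-∉-generated d₁ λ s∈₂ → G₂#G₃ (s∈₂ , s∈))
        (registered-own d₂ u₃))))

record Faithful (Δc : CCtx) (Δ : FCtx) (G : List RName) : Set where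
  field
    agree      : ∀ r → r ∉ G → Agree Δc Δ r
    equation   : ∀ {n T₁ T₂} → ceq n T₁ T₂ ∈ Δc → Translated Δ n T₁ T₂
    definition : ∀ {r m h ts} → cdef r m h ts ∈ Δc → ∃ λ U → fdef r m U ∈ Δ

lookupF-fresh : ∀ {Δc Δ G G′ E} → Faithful Δc Δ G → Disjoint G G′ →
                All (λ r → ¬ Any (RinE r) (Δc ++ E)) G′ → ∀ {s} → s ∈ G′ → lookupF s Δ ≡ nothing
lookupF-fresh {Δc} F G#G′ fresh′ {s} s∈ with Faithful.agree F s (λ s∈G → G#G′ (s∈G , s∈))
... | undefined _ f   = f
... | defined _ c _ _ with trans (sym c) (lookupC-unmentioned Δc (All.lookup fresh′ s∈ ∘ Any.++⁺ˡ))
...   | ()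

faithful-[] : Faithful [] [] []
faithful-[] = record { agree = λ _ _ → undefined refl refl ; equation = λ () ; definition = λ () }

faithful-eq : ∀ {Δc Δ₁ Δ₂ Δ₃ G₁ G₂ G₃ n} {T₁ T₂ : Tm n} {N₁ N₂} →
              Faithful Δc Δ₁ G₁ →
              (d₁ : T₁ ▷rec N₁ ◇ Δ₂ ∣ G₂) (d₂ : T₂ ▷rec N₂ ◇ Δ₃ ∣ G₃) →
              Unique (G₂ ++ G₃) → (∀ {s} → s ∈ G₂ ++ G₃ → lookupF s Δ₁ ≡ nothing) →
              Faithful (Δc ∷ʳ ceq n T₁ T₂) ((Δ₁ ++ Δ₂ ++ Δ₃) ∷ʳ eqN n N₁ N₂)
                       (G₁ ++ G₂ ++ G₃)
faithful-eq {Δc} {Δ₁} {Δ₂} {Δ₃} {G₁} {G₂} {G₃} {n} {T₁} {T₂} {N₁} {N₂} F d₁ d₂ u₂₃ Δ₁∌ =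
  record { agree = agree′ ; equation = equation′ ; definition = definition′ }
  where
    open Faithful F
    Δ = (Δ₁ ++ Δ₂ ++ Δ₃) ∷ʳ eqN n N₁ N₂

    grow : Δ₁ ≼ Δ
    grow = ≼-trans (≼-++ʳ Δ₁) (≼-++ʳ (Δ₁ ++ Δ₂ ++ Δ₃))

    agree′ : ∀ r → r ∉ G₁ ++ G₂ ++ G₃ → Agree (Δc ∷ʳ ceq n T₁ T₂) Δ r
    agree′ r r∉ = agree-mono (lookupC-++ˡ Δc) grow new (agree r (r∉ ∘ ∈-++⁺ˡ))
      where
        new : lookupC r Δc ≡ nothing → lookupF r Δ₁ ≡ nothing → Agree (Δc ∷ʳ ceq n T₁ T₂) Δ r
        new c f = undefined (lookupC-++ʳ Δc c) (lookupF-++ʳ (Δ₁ ++ Δ₂ ++ Δ₃) (begin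
          lookupF r (Δ₁ ++ Δ₂ ++ Δ₃) ≡⟨ lookupF-++ʳ Δ₁ f ⟩
          lookupF r (Δ₂ ++ Δ₃)       ≡⟨ lookupF-++ʳ Δ₂ (lookupF-∉-generated d₁ (r∉ ∘ ∈-++⁺ʳ G₁ ∘ ∈-++⁺ˡ)) ⟩
          lookupF r Δ₃               ≡⟨ lookupF-∉-generated d₂ (r∉ ∘ ∈-++⁺ʳ G₁ ∘ ∈-++⁺ʳ G₂) ⟩
          nothing                    ∎))
          where open ≡-Reasoning

    equation′ : ∀ {n′ T₁′ T₂′} →
                ceq n′ T₁′ T₂′ ∈ Δc ∷ʳ ceq n T₁ T₂ → Translated Δ n′ T₁′ T₂′
    equation′ e∈ with ∈-++⁻ Δc e∈
    ... | inj₁ old       = translated-mono grow (equation old)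
    ... | inj₂ (here refl) = translated-new Δ₁ d₁ d₂ u₂₃ Δ₁∌

    definition′ : ∀ {r m h ts} → cdef r m h ts ∈ Δc ∷ʳ ceq n T₁ T₂ → ∃ λ U → fdef r m U ∈ Δ
    definition′ d∈ with ∈-++⁻ Δc d∈
    ... | inj₁ old with definition old
    ...   | U , f∈ = U , members grow f∈
    definition′ d∈ | inj₂ (here ())
    definition′ d∈ | inj₂ (there ())

faithful-def : ∀ {Δc Δ₁ Δ₂ G₁ G₂ r m} {h : Head m} {ts ns} →
               Faithful Δc Δ₁ G₁ → (ds : ts ▷recs ns ◇ Δ₂ ∣ G₂) →
               Unique G₂ → (∀ {s} → s ∈ G₂ → lookupF s Δ₁ ≡ nothing) →
               Faithful (Δc ∷ʳ cdef r m h ts) ((Δ₁ ++ Δ₂) ∷ʳ fdef r m (appH h ns)) (G₁ ++ G₂)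
faithful-def {Δc} {Δ₁} {Δ₂} {G₁} {G₂} {r₀} {m₀} {h₀} {ts₀} {ns₀} F ds u₂ Δ₁∌ =
  record { agree = agree′ ; equation = equation′ ; definition = definition′ }
  where
    open Faithful F
    Δ = (Δ₁ ++ Δ₂) ∷ʳ fdef r₀ m₀ (appH h₀ ns₀)

    grow : Δ₁ ≼ Δ
    grow = ≼-trans (≼-++ʳ Δ₁) (≼-++ʳ (Δ₁ ++ Δ₂))

    agree′ : ∀ r → r ∉ G₁ ++ G₂ → Agree (Δc ∷ʳ cdef r₀ m₀ h₀ ts₀) Δ r
    agree′ r r∉ = agree-mono (lookupC-++ˡ Δc) grow new (agree r (r∉ ∘ ∈-++⁺ˡ))
      where
        old-F : lookupF r Δ₁ ≡ nothing → lookupF r Δ ≡ lookupF r (fdef r₀ m₀ (appH h₀ ns₀) ∷ [])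
        old-F f = lookupF-++ʳ (Δ₁ ++ Δ₂)
          (trans (lookupF-++ʳ Δ₁ f) (lookupF-∉-generated* ds (r∉ ∘ ∈-++⁺ʳ G₁)))

        new : lookupC r Δc ≡ nothing → lookupF r Δ₁ ≡ nothing →
              Agree (Δc ∷ʳ cdef r₀ m₀ h₀ ts₀) Δ r
        new c f with r ≟ r₀
        ... | yes refl = defined ds
          (trans (lookupC-++ʳ Δc c) (lookupC-here r m₀ h₀ ts₀ []))
          (trans (old-F f) (lookupF-here r m₀ (appH h₀ ns₀) []))
          (registered*-mono (≼-++ʳ (Δ₁ ++ Δ₂)) ds (registered*-++ˡ Δ₁ ds Δ₁∌ (registered*-own ds u₂)))
        ... | no r≢r₀ = undefined
          (trans (lookupC-++ʳ Δc c) (lookupC-there m₀ h₀ ts₀ [] r≢r₀))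
          (trans (old-F f) (lookupF-there m₀ (appH h₀ ns₀) [] r≢r₀))

    equation′ : ∀ {n T₁ T₂} →
                ceq n T₁ T₂ ∈ Δc ∷ʳ cdef r₀ m₀ h₀ ts₀ → Translated Δ n T₁ T₂
    equation′ e∈ with ∈-++⁻ Δc e∈
    ... | inj₁ old = translated-mono grow (equation old)
    ... | inj₂ (here ())
    ... | inj₂ (there ())

    definition′ : ∀ {r m h ts} →
                  cdef r m h ts ∈ Δc ∷ʳ cdef r₀ m₀ h₀ ts₀ → ∃ λ U → fdef r m U ∈ Δ
    definition′ d∈ with ∈-++⁻ Δc d∈
    ... | inj₁ old with definition old
    ...   | U , f∈ = U , members grow f∈
    definition′ d∈ | inj₂ (here refl) = appH h₀ ns₀ , ∈-++⁺ʳ (Δ₁ ++ Δ₂) (here refl)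

faithful : ∀ {Δc Δ G} → Δc ▷ctx Δ ∣ G →
           Unique G → All (λ r → ¬ Any (RinE r) Δc) G → Faithful Δc Δ G
faithful [] _ _ = faithful-[]
faithful (eq {G₁ = G₁} tr d₁ d₂) uniq fresh with unique-++⁻ G₁ uniq | All.++⁻ G₁ fresh
... | u₁ , u′ , G₁#G′ | fresh₁ , fresh′ =
  faithful-eq F d₁ d₂ u′ (lookupF-fresh F G₁#G′ fresh′)
  where F = faithful tr u₁ (All.map (_∘ Any.++⁺ˡ) fresh₁)
faithful (def {G₁ = G₁} tr (app ds)) uniq fresh with unique-++⁻ G₁ uniq | All.++⁻ G₁ fresh
... | u₁ , u′ , G₁#G′ | fresh₁ , fresh′ =
  faithful-def F ds u′ (lookupF-fresh F G₁#G′ fresh′)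
  where F = faithful tr u₁ (All.map (_∘ Any.++⁺ˡ) fresh₁)

corollary3p2 : (Δc : CCtx) (Δ : FCtx) → Δc ▷ Δ →
    ((n : ℕ) (T₁ T₂ : Tm n) → ceq n T₁ T₂ ∈ Δc →
      Σ (FN n) λ N₁ → Σ (FN n) λ N₂ → (eqN n N₁ N₂ ∈ Δ) ×
        ((k : ℕ) → (expC Δc k T₁ ≡ expN Δ k N₁) × (expC Δc k T₂ ≡ expN Δ k N₂)))
    × ((r : RName) (m : ℕ) (h : Head m) (ts : List (Tm m)) → cdef r m h ts ∈ Δc →
      Σ ℕ λ m′ → Σ (UBody m′) λ U → (fdef r m′ U ∈ Δ) ×
        ((n l : ℕ) (ys : List (Fin (l + n))) (k : ℕ) →
          expC Δc k (lam l (rc r ys)) ≡ expN Δ k (nrec l r ys)))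
corollary3p2 Δc Δ (G , tr , uniq , fresh) =
  (λ n T₁ T₂ e∈ → translated-expansions (lose e∈ ∘ eqL) (lose e∈ ∘ eqR) (equation e∈)) ,
  (λ r m h ts d∈ → let U , f∈ = definition d∈ in
     m , U , f∈ , λ n l ys k → expC-rc≡expN-nrec k l ys (lose d∈ defL))
  where
    open Faithful (faithful tr uniq fresh)
    open Expansion Δc Δ (λ {r} r∈ → agree r λ r∈G → All.lookup fresh r∈G r∈)
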